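{- Let $k$ be a positive integer and let $G_k$ be a graph that has no packing $(1^2,2^k)$-coloring but every proper subgraph of which has a packing $(1^2,2^k)$-coloring. If a vertex $u$ of $G_k$ has no neighbor of degree at least $3$, then $u$ has degree at least $k+2$.
   Context: All graphs are finite and simple. A set of vertices is $i$-independent if any two distinct vertices in it are at distance at least $i+1$. A packing $(1^{\ell},2^{k})$-coloring of $G$ is a partition of $V(G)$ into $\ell$ independent sets and $k$ $2$-independent sets (some parts may be empty). -}

module Defs where

open import Data.Nat using (ℕ; zero; suc; _+_; _<_; _≤_)
open import Data.Fin using (Fin; toℕ)
open import Data.Bool using (Bool; true; false; T; if_then_else_)
open import Data.List using (map; allFin)
open import Data.Nat.ListAction using (sum)
open import Data.Product using (Σ; ∃; _×_; _,_)
open import Relation.Nullary using (¬_)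
open import Relation.Binary.PropositionalEquality using (_≡_; _≢_)
open import Function.Definitions using (Injective; Surjective)

record Graph : Set where
  field
    n     : ℕ
    adj   : Fin n → Fin n → Bool
    sym   : ∀ x y → adj x y ≡ adj y x
    irrefl : ∀ x → adj x x ≡ false
open Graph public

Adj : (G : Graph) → Fin (n G) → Fin (n G) → Set
Adj G x y = T (adj G x y)

degree : (G : Graph) → Fin (n G) → ℕ
degree G v = sum (map (λ w → if adj G v w then 1 else 0) (allFin (n G)))

record SubgraphEmb (H G : Graph) : Set where
  field
    f       : Fin (n H) → Fin (n G)
    f-inj   : Injective _≡_ _≡_ f
    f-edge  : ∀ x y → Adj H x y → Adj G (f x) (f y)
open SubgraphEmb public

IsProper : {H G : Graph} → SubgraphEmb H G → Set
IsProper {H} {G} e =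
  ¬ (Surjective _≡_ _≡_ (f e) × (∀ x y → Adj G (f e x) (f e y) → Adj H x y))

ProperSubgraph : Graph → Graph → Set
ProperSubgraph H G = Σ (SubgraphEmb H G) IsProper

-- Packing (1^ℓ, 2^k)-colouring: c : V → Fin (ℓ + k); colours with index < ℓ
-- are independent sets, colours with index ≥ ℓ are 2-independent sets
-- (distinct vertices at distance ≥ 3: not adjacent and no common neighbour).
record PackingColoring (ℓ k : ℕ) (G : Graph) : Set where
  field
    col  : Fin (n G) → Fin (ℓ + k)
    ind1 : ∀ x y → Adj G x y → col x ≢ col y
    ind2 : ∀ x y → x ≢ y → col x ≡ col y → ℓ ≤ toℕ (col x) →
             ¬ Adj G x y × (∀ z → ¬ (Adj G x z × Adj G z y))

HasPackingColoring : ℕ → ℕ → Graph → Set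
HasPackingColoring ℓ k G = PackingColoring ℓ k G

-- Take a packing colouring c of G − u (by minimality) and try to extend it to G. Every
-- neighbour of u has at most one neighbour besides u, so recolouring N(u) with the
-- independent colours 0 and 1 only has to respect one further vertex per neighbour.
-- If some 2-independent colour γ does not occur at distance exactly 2 from u, give u the
-- colour γ and colour N(u) from {0, 1}; this works because N(u) induces a matching.
-- Otherwise each of the k such colours is seen by its own neighbour of u, through that
-- neighbour's unique far neighbour. Two further ("light") neighbours give degree ≥ k + 2;
-- with at most one light neighbour N(u) is independent, and one of the colours 0, 1 can
-- be put on all of N(u) and the other on u.

module Submission where

open import Data.Bool using (Bool; true; T; if_then_else_)
open import Data.Bool.Properties using (T?)
open import Data.Empty using (⊥-elim)
open import Data.Fin as Fin using (Fin; zero; suc; toℕ; punchIn; punchOut; _↑ˡ_; _↑ʳ_)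
open import Data.Fin.Properties
  using (_≟_; any?; all?; ¬∀⟶∃¬; ¬Fin0; 0≢1+n; <-cmp; <-asym; ↑ˡ-injective; ↑ʳ-injective;
         punchIn-injective; punchInᵢ≢i; punchIn-punchOut; punchOut-injective; punchOut-cong)
  renaming (_<?_ to _<ᶠ?_)
open import Data.List using (tabulate)
open import Data.List.Properties using (map-tabulate)
open import Data.Nat using (ℕ; zero; suc; _+_; _≤_; _<_; z≤n; s≤s; _≤?_)
open import Data.Nat.ListAction using (sum)
open import Data.Nat.Properties using (≤-trans; m≤n+m; +-comm; <⇒≱)
open import Data.Product using (∃; ∃₂; _×_; _,_; proj₁; proj₂)
open import Data.Sum using (_⊎_; inj₁; inj₂)
open import Data.Vec as Vec using (Vec; []; _∷_)
open import Data.Vec.Relation.Unary.All as All using (All; []; _∷_)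
import Data.Vec.Relation.Unary.All.Properties as All
open import Data.Vec.Relation.Unary.Unique.Propositional using (Unique; []; _∷_)
import Data.Vec.Relation.Unary.Unique.Propositional.Properties as Unique
open import Function using (_∘_; id)
open import Function.Definitions using (Injective)
open import Relation.Binary using (tri<; tri≈; tri>)
open import Relation.Binary.PropositionalEquality using (_≡_; _≢_; refl; sym; trans; cong; subst; subst₂)
open import Relation.Nullary using (¬_; Dec; yes; no)
open import Relation.Nullary.Decidable using (_×-dec_; _⊎-dec_; ¬?)

open import Defs hiding (sym)

count : ∀ {n} → (Fin n → Bool) → ℕ
count p = sum (tabulate (λ w → if p w then 1 else 0))

count-true : ∀ {n} (p : Fin (suc n) → Bool) → T (p zero) → count p ≡ suc (count (p ∘ suc))
count-true p t with p zero
... | true = refl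

injective⇒≤count : ∀ {m n} (p : Fin n → Bool) {h : Fin m → Fin n} →
  Injective _≡_ _≡_ h → (∀ i → T (p (h i))) → m ≤ count p
injective⇒≤count-suc : ∀ {m n} (p : Fin (suc n) → Bool) {h : Fin m → Fin (suc n)} →
  Injective _≡_ _≡_ h → (∀ i → zero ≢ h i) → (∀ i → T (p (h i))) → m ≤ count (p ∘ suc)

injective⇒≤count {zero} p _ _ = z≤n
injective⇒≤count {suc m} {zero} p {h} _ _ = ⊥-elim (¬Fin0 (h zero))
injective⇒≤count {suc m} {suc n} p {h} h-inj ph with any? (λ i → zero ≟ h i)
... | no 0∉h = ≤-trans (injective⇒≤count-suc p h-inj (λ i e → 0∉h (i , e)) ph) (m≤n+m _ _)
... | yes (i , 0≡hi) =
  subst (suc m ≤_) (sym (count-true p (subst (T ∘ p) (sym 0≡hi) (ph i))))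
    (s≤s (injective⇒≤count-suc p (punchIn-injective i _ _ ∘ h-inj) 0∉h′ (ph ∘ punchIn i)))
  where
  0∉h′ : ∀ j → zero ≢ h (punchIn i j)
  0∉h′ j e = punchInᵢ≢i i j (h-inj (trans (sym e) 0≡hi))

injective⇒≤count-suc p {h} h-inj 0∉h ph =
  injective⇒≤count (p ∘ suc) (h-inj ∘ punchOut-injective (0∉h _) (0∉h _))
    (λ i → subst (T ∘ p) (sym (punchIn-punchOut (0∉h i))) (ph i))

degree≡count : ∀ G v → degree G v ≡ count (adj G v)
degree≡count G v = cong sum (map-tabulate {n = n G} id (λ w → if adj G v w then 1 else 0))

distinct-neighbours≤degree : ∀ {m} G v {xs : Vec (Fin (n G)) m} →
  Unique xs → All (Adj G v) xs → m ≤ degree G v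
distinct-neighbours≤degree G v xs-unique xs-adj =
  subst (_ ≤_) (sym (degree≡count G v))
    (injective⇒≤count (adj G v) (Unique.lookup-injective xs-unique _ _) (All.lookup⁺ xs-adj))

_─_ : (G : Graph) → Fin (n G) → Graph
record { n = suc m ; adj = a ; sym = s ; irrefl = i } ─ u = record
  { n = m ; adj = λ x y → a (punchIn u x) (punchIn u y)
  ; sym = λ x y → s _ _ ; irrefl = λ x → i _ }

─-proper : (G : Graph) (u : Fin (n G)) → ProperSubgraph (G ─ u) G
─-proper record { n = suc m } u =
  record { f = punchIn u ; f-inj = punchIn-injective u _ _ ; f-edge = λ _ _ e → e } ,
  λ (onto , _) → let (x , x↦u) = onto u in punchInᵢ≢i u x (x↦u refl)

-- A packing colouring of G − u read on the vertices of G: col u is junk.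
record PackingColoringOff (ℓ k : ℕ) (G : Graph) (u : Fin (n G)) : Set where
  field
    col  : Fin (n G) → Fin (ℓ + k)
    ind1 : ∀ x y → x ≢ u → y ≢ u → Adj G x y → col x ≢ col y
    ind2 : ∀ x y → x ≢ u → y ≢ u → x ≢ y → col x ≡ col y → ℓ ≤ toℕ (col x) →
             ¬ Adj G x y × (∀ z → z ≢ u → ¬ (Adj G x z × Adj G z y))

restrict : ∀ {ℓ k} (G : Graph) (u : Fin (n G)) →
  PackingColoring (suc ℓ) k (G ─ u) → PackingColoringOff (suc ℓ) k G u
restrict {ℓ} {k} G@record { n = suc m ; adj = a } u c =
  record { col = col′ ; ind1 = ind1′ ; ind2 = ind2′ }
  where
  open PackingColoring c

  out : ∀ {x} → x ≢ u → Fin m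
  out x≢u = punchOut (x≢u ∘ sym)

  in-out : ∀ {x} (x≢u : x ≢ u) → punchIn u (out x≢u) ≡ x
  in-out x≢u = punchIn-punchOut (x≢u ∘ sym)

  col′ : Fin (suc m) → Fin (suc ℓ + k)
  col′ x with x ≟ u
  ... | yes _ = zero
  ... | no x≢u = col (out x≢u)

  col′-out : ∀ {x} (x≢u : x ≢ u) → col′ x ≡ col (out x≢u)
  col′-out {x} x≢u with x ≟ u
  ... | yes x≡u = ⊥-elim (x≢u x≡u)
  ... | no _ = cong col (punchOut-cong u refl)

  same-out : ∀ {x y} (x≢u : x ≢ u) (y≢u : y ≢ u) → col′ x ≡ col′ y → col (out x≢u) ≡ col (out y≢u)
  same-out x≢u y≢u e = trans (sym (col′-out x≢u)) (trans e (col′-out y≢u))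

  adj-out : ∀ {x y} (x≢u : x ≢ u) (y≢u : y ≢ u) → Adj G x y → Adj (G ─ u) (out x≢u) (out y≢u)
  adj-out x≢u y≢u = subst₂ (λ x y → T (a x y)) (sym (in-out x≢u)) (sym (in-out y≢u))

  ind1′ : ∀ x y → x ≢ u → y ≢ u → Adj G x y → col′ x ≢ col′ y
  ind1′ x y x≢u y≢u xy = ind1 _ _ (adj-out x≢u y≢u xy) ∘ same-out x≢u y≢u

  ind2′ : ∀ x y → x ≢ u → y ≢ u → x ≢ y → col′ x ≡ col′ y → suc ℓ ≤ toℕ (col′ x) →
            ¬ Adj G x y × (∀ z → z ≢ u → ¬ (Adj G x z × Adj G z y))
  ind2′ x y x≢u y≢u x≢y e packed =
    let ¬xy , no-middle = ind2 _ _ outs-differ (same-out x≢u y≢u e)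
                            (subst (λ d → suc ℓ ≤ toℕ d) (col′-out x≢u) packed)
    in ¬xy ∘ adj-out x≢u y≢u ,
       λ z z≢u (xz , zy) → no-middle (out z≢u) (adj-out x≢u z≢u xz , adj-out z≢u y≢u zy)
    where
    outs-differ : out x≢u ≢ out y≢u
    outs-differ e′ = x≢y (trans (sym (in-out x≢u)) (trans (cong (punchIn u) e′) (in-out y≢u)))

module _ (G : Graph) where

  Adj-sym : ∀ {x y} → Adj G x y → Adj G y x
  Adj-sym {x} {y} = subst T (Graph.sym G x y)

  Adj-irrefl : ∀ {x} → ¬ Adj G x x
  Adj-irrefl {x} = subst T (irrefl G x)

  Adj⇒≢ : ∀ {x y} → Adj G x y → x ≢ y
  Adj⇒≢ xy refl = Adj-irrefl xy

  Adj? : ∀ x y → Dec (Adj G x y)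
  Adj? x y = T? (adj G x y)

one-colour-unpacked : ∀ {k} (i : Fin 2) → ¬ 2 ≤ toℕ (i ↑ˡ k)
one-colour-unpacked zero ()
one-colour-unpacked (suc zero) (s≤s ())

module _ {k : ℕ} (G : Graph) (u : Fin (n G)) (c : PackingColoringOff 2 k G u) where
  open PackingColoringOff c

  Far : Fin (n G) → Set
  Far x = x ≢ u × ¬ Adj G u x

  Far? : ∀ x → Dec (Far x)
  Far? x = ¬? (x ≟ u) ×-dec ¬? (Adj? G u x)

  data Position : Fin (n G) → Set where
    centre : Position u
    near   : ∀ {x} → Adj G u x → Position x
    far    : ∀ {x} → Far x → Position x

  position : ∀ x → Position x
  position x with x ≟ u | Adj? G u x
  ... | yes refl | _       = centre
  ... | no _     | yes ux  = near ux
  ... | no x≢u   | no ¬ux  = far (x≢u , ¬ux)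

  module Extension (cu : Fin (2 + k)) (nb : Fin (n G) → Fin 2)
    (centre≢near : ∀ v → Adj G u v → cu ≢ nb v ↑ˡ k)
    (near-proper : ∀ v v′ → Adj G u v → Adj G u v′ → Adj G v v′ → nb v ≢ nb v′)
    (near≢far : ∀ v x → Adj G u v → Far x → Adj G v x → nb v ↑ˡ k ≢ col x)
    (centre-packed : 2 ≤ toℕ cu → ∀ v x → Adj G u v → Far x → Adj G v x → col x ≢ cu)
    where

    recolour : ∀ {x} → Position x → Fin (2 + k)
    recolour centre       = cu
    recolour {x} (near _) = nb x ↑ˡ k
    recolour {x} (far _)  = col x

    proper : ∀ x y → Adj G x y → recolour (position x) ≢ recolour (position y)
    proper x y xy with position x | position y
    ... | centre         | centre         = ⊥-elim (Adj-irrefl G xy)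
    ... | centre         | near _         = centre≢near y xy
    ... | centre         | far (_ , ¬uy)  = ⊥-elim (¬uy xy)
    ... | near _         | centre         = centre≢near x (Adj-sym G xy) ∘ sym
    ... | near ux        | near uy        = near-proper x y ux uy xy ∘ ↑ˡ-injective k _ _
    ... | near ux        | far fy         = near≢far x y ux fy xy
    ... | far (_ , ¬ux)  | centre         = ⊥-elim (¬ux (Adj-sym G xy))
    ... | far fx         | near uy        = near≢far y x uy fx (Adj-sym G xy) ∘ sym
    ... | far (x≢u , _)  | far (y≢u , _)  = ind1 x y x≢u y≢u xy

    packed : ∀ x y → x ≢ y → recolour (position x) ≡ recolour (position y) →
      2 ≤ toℕ (recolour (position x)) → ¬ Adj G x y × (∀ z → ¬ (Adj G x z × Adj G z y))
    packed x y x≢y same two with position x | position y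
    ... | near _  | _      = ⊥-elim (one-colour-unpacked (nb x) two)
    ... | _       | near _ = ⊥-elim (one-colour-unpacked (nb y) (subst (λ d → 2 ≤ toℕ d) same two))
    ... | centre  | centre = ⊥-elim (x≢y refl)
    ... | centre  | far fy =
      proj₂ fy , λ z (uz , zy) → centre-packed two z y uz fy zy (sym same)
    ... | far fx  | centre =
      proj₂ fx ∘ Adj-sym G ,
      λ z (xz , zu) → centre-packed (subst (λ d → 2 ≤ toℕ d) same two) z x
                        (Adj-sym G zu) fx (Adj-sym G xz) same
    ... | far (x≢u , ¬ux) | far (y≢u , _) =
      let ¬xy , no-middle = ind2 x y x≢u y≢u x≢y same two
      in ¬xy , λ z (xz , zy) → no-middle z (λ { refl → ¬ux (Adj-sym G xz) }) (xz , zy)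

    coloring : PackingColoring 2 k G
    coloring = record { col = recolour ∘ position ; ind1 = proper ; ind2 = packed }

  ≢centre : ∀ {v} → Adj G u v → v ≢ u
  ≢centre uv = Adj⇒≢ G uv ∘ sym

  OccursAtDistanceTwo : Fin k → Set
  OccursAtDistanceTwo γ = ∃₂ λ v x → Adj G u v × Far x × Adj G v x × col x ≡ 2 ↑ʳ γ

  OccursAtDistanceTwo? : ∀ γ → Dec (OccursAtDistanceTwo γ)
  OccursAtDistanceTwo? γ = any? λ v → any? λ x →
    Adj? G u v ×-dec Far? x ×-dec Adj? G v x ×-dec (col x ≟ 2 ↑ʳ γ)

  FarPacked : Fin (n G) → Set
  FarPacked v = ∃ λ x → Far x × Adj G v x × 2 ≤ toℕ (col x)

  Light : Fin (n G) → Set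
  Light v = Adj G u v × ¬ FarPacked v

  Light? : ∀ v → Dec (Light v)
  Light? v = Adj? G u v ×-dec ¬? (any? λ x → Far? x ×-dec Adj? G v x ×-dec (2 ≤? toℕ (col x)))

  module _ (small : ∀ v → Adj G u v → degree G v < 3) where

    other-neighbour-unique : ∀ {v a b} → Adj G u v → a ≢ u → b ≢ u →
      Adj G v a → Adj G v b → a ≡ b
    other-neighbour-unique {v} {a} {b} uv a≢u b≢u va vb with a ≟ b
    ... | yes a≡b = a≡b
    ... | no a≢b = ⊥-elim (<⇒≱ (small v uv)
                     (distinct-neighbours≤degree G v distinct (Adj-sym G uv ∷ va ∷ vb ∷ [])))
      where
      distinct : Unique (u ∷ a ∷ b ∷ [])
      distinct = ((a≢u ∘ sym) ∷ (b≢u ∘ sym) ∷ []) ∷ (a≢b ∷ []) ∷ [] ∷ []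

    module _ (γ : Fin k) (γ-absent : ¬ OccursAtDistanceTwo γ) where

      -- A neighbour with a partner inside N(u) has no far neighbour, so the two
      -- alternatives never compete.
      Pushed : Fin (n G) → Set
      Pushed v = (∃ λ w → Far w × Adj G v w × col w ≡ zero)
               ⊎ (∃ λ w → Adj G u w × Adj G v w × w Fin.< v)

      Pushed? : ∀ v → Dec (Pushed v)
      Pushed? v = any? (λ w → Far? w ×-dec Adj? G v w ×-dec (col w ≟ zero))
           ⊎-dec any? (λ w → Adj? G u w ×-dec Adj? G v w ×-dec (w <ᶠ? v))

      near-colour : Fin (n G) → Fin 2
      near-colour v with Pushed? v
      ... | yes _ = suc zero
      ... | no _  = zero

      pushed⇒> : ∀ {v v′} → Adj G u v → Adj G u v′ → Adj G v v′ → Pushed v → v′ Fin.< v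
      pushed⇒> uv uv′ vv′ (inj₁ (w , (w≢u , ¬uw) , vw , _)) =
        ⊥-elim (¬uw (subst (Adj G u) (other-neighbour-unique uv (≢centre uv′) w≢u vv′ vw) uv′))
      pushed⇒> uv uv′ vv′ (inj₂ (w , uw , vw , w<v)) =
        subst (Fin._< _) (other-neighbour-unique uv (≢centre uw) (≢centre uv′) vw vv′) w<v

      near-colour-proper : ∀ v v′ → Adj G u v → Adj G u v′ → Adj G v v′ →
        near-colour v ≢ near-colour v′
      near-colour-proper v v′ uv uv′ vv′ with Pushed? v | Pushed? v′
      ... | yes p | yes p′ =
        λ _ → <-asym (pushed⇒> uv uv′ vv′ p) (pushed⇒> uv′ uv (Adj-sym G vv′) p′)
      ... | yes _ | no _ = λ ()
      ... | no _  | yes _ = λ ()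
      ... | no ¬p | no ¬p′ with <-cmp v v′
      ... | tri< v<v′ _ _ = λ _ → ¬p′ (inj₂ (v , uv , Adj-sym G vv′ , v<v′))
      ... | tri≈ _ v≡v′ _ = λ _ → Adj⇒≢ G vv′ v≡v′
      ... | tri> _ _ v′<v = λ _ → ¬p (inj₂ (v′ , uv′ , vv′ , v′<v))

      near-colour≢far : ∀ v x → Adj G u v → Far x → Adj G v x → near-colour v ↑ˡ k ≢ col x
      near-colour≢far v x uv fx vx with Pushed? v
      ... | no ¬p = λ e → ¬p (inj₁ (x , fx , vx , sym e))
      ... | yes (inj₁ (w , (w≢u , _) , vw , w0)) = λ e →
        0≢1+n (sym (trans e (trans (cong col (other-neighbour-unique uv (proj₁ fx) w≢u vx vw)) w0)))
      ... | yes (inj₂ (w , uw , vw , _)) =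
        ⊥-elim (proj₂ fx (subst (Adj G u) (other-neighbour-unique uv (≢centre uw) (proj₁ fx) vw vx) uw))

      missing-colour-coloring : PackingColoring 2 k G
      missing-colour-coloring =
        Extension.coloring (2 ↑ʳ γ) near-colour
          (λ v _ e → one-colour-unpacked (near-colour v) (subst (λ d → 2 ≤ toℕ d) e (s≤s (s≤s z≤n))))
          near-colour-proper near-colour≢far
          (λ _ v x uv fx vx e → γ-absent (v , x , uv , fx , vx , e))

    two-light⇒k+2≤degree : (∀ γ → OccursAtDistanceTwo γ) →
      ∀ {y y′} → y ≢ y′ → Light y → Light y′ → k + 2 ≤ degree G u
    two-light⇒k+2≤degree occurs {y} {y′} y≢y′ (uy , ¬py) (uy′ , ¬py′) =
      subst (_≤ degree G u) (+-comm 2 k) (distinct-neighbours≤degree G u distinct adjacent)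
      where
      witness : Fin k → Fin (n G)
      witness γ = proj₁ (occurs γ)

      witness-farPacked : ∀ γ → FarPacked (witness γ)
      witness-farPacked γ with occurs γ
      ... | _ , x , _ , fx , vx , x≡γ = x , fx , vx , subst (λ d → 2 ≤ toℕ d) (sym x≡γ) (s≤s (s≤s z≤n))

      witness-injective : ∀ {γ γ′} → witness γ ≡ witness γ′ → γ ≡ γ′
      witness-injective {γ} {γ′} e with occurs γ | occurs γ′ | e
      ... | v , x , uv , fx , vx , x≡γ | _ , x′ , _ , fx′ , vx′ , x′≡γ′ | refl =
        ↑ʳ-injective 2 γ γ′ (trans (sym x≡γ)
          (trans (cong col (other-neighbour-unique uv (proj₁ fx) (proj₁ fx′) vx vx′)) x′≡γ′))

      not-witness : ∀ {y} → ¬ FarPacked y → All (y ≢_) (Vec.tabulate witness)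
      not-witness ¬py = All.tabulate⁺ λ γ e → ¬py (subst FarPacked (sym e) (witness-farPacked γ))

      distinct : Unique (y ∷ y′ ∷ Vec.tabulate witness)
      distinct = (y≢y′ ∷ not-witness ¬py) ∷ not-witness ¬py′ ∷ Unique.tabulate⁺ witness-injective

      adjacent : All (Adj G u) (y ∷ y′ ∷ Vec.tabulate witness)
      adjacent = uy ∷ uy′ ∷ All.tabulate⁺ λ γ → proj₁ (proj₂ (proj₂ (occurs γ)))

    module _ (light-unique : ∀ {y y′} → Light y → Light y′ → y ≡ y′) where

      near-independent : ∀ {v v′} → Adj G u v → Adj G u v′ → ¬ Adj G v v′
      near-independent uv uv′ vv′ =
        Adj⇒≢ G vv′ (light-unique (light uv uv′ vv′) (light uv′ uv (Adj-sym G vv′)))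
        where
        light : ∀ {v v′} → Adj G u v → Adj G u v′ → Adj G v v′ → Light v
        light uv uv′ vv′ = uv , λ (x , (x≢u , ¬ux) , vx , _) →
          ¬ux (subst (Adj G u) (other-neighbour-unique uv (≢centre uv′) x≢u vv′ vx) uv′)

      Hits : Fin 2 → Set
      Hits i = ∃₂ λ v x → Adj G u v × Far x × Adj G v x × col x ≡ i ↑ˡ k

      Hits? : ∀ i → Dec (Hits i)
      Hits? i = any? λ v → any? λ x →
        Adj? G u v ×-dec Far? x ×-dec Adj? G v x ×-dec (col x ≟ i ↑ˡ k)

      hit⇒light : ∀ {i v x} → Adj G u v → Far x → Adj G v x → col x ≡ i ↑ˡ k → Light v
      hit⇒light {i} uv fx vx x≡i = uv , λ (x′ , fx′ , vx′ , two) →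
        one-colour-unpacked i (subst (λ y → 2 ≤ toℕ y)
          (trans (cong col (other-neighbour-unique uv (proj₁ fx′) (proj₁ fx) vx′ vx)) x≡i) two)

      ¬hits-both : Hits zero → ¬ Hits (suc zero)
      ¬hits-both (v , x , uv , fx , vx , x≡0) (v′ , x′ , uv′ , fx′ , vx′ , x′≡1)
        with light-unique (hit⇒light uv fx vx x≡0) (hit⇒light uv′ fx′ vx′ x′≡1)
      ... | refl = 0≢1+n (trans (sym x≡0)
                   (trans (cong col (other-neighbour-unique uv (proj₁ fx) (proj₁ fx′) vx vx′)) x′≡1))

      constant-near-coloring : (i j : Fin 2) → i ≢ j → ¬ Hits j → PackingColoring 2 k G
      constant-near-coloring i j i≢j ¬hits =
        Extension.coloring (i ↑ˡ k) (λ _ → j)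
          (λ _ _ → i≢j ∘ ↑ˡ-injective k i j)
          (λ _ _ uv uv′ vv′ → ⊥-elim (near-independent uv uv′ vv′))
          (λ v x uv fx vx e → ¬hits (v , x , uv , fx , vx , sym e))
          (λ two → ⊥-elim (one-colour-unpacked i two))

      one-light-coloring : PackingColoring 2 k G
      one-light-coloring with Hits? (suc zero)
      ... | yes hits1 = constant-near-coloring (suc zero) zero (λ ()) (λ hits0 → ¬hits-both hits0 hits1)
      ... | no ¬hits1 = constant-near-coloring zero (suc zero) (λ ()) ¬hits1

    k+2≤degree⊎coloring : k + 2 ≤ degree G u ⊎ PackingColoring 2 k G
    k+2≤degree⊎coloring with all? OccursAtDistanceTwo?
    ... | no ¬occurs =
      let γ , γ-absent = ¬∀⟶∃¬ k OccursAtDistanceTwo OccursAtDistanceTwo? ¬occurs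
      in inj₂ (missing-colour-coloring γ γ-absent)
    ... | yes occurs with any? (λ y → any? λ y′ → ¬? (y ≟ y′) ×-dec Light? y ×-dec Light? y′)
    ... | yes (y , y′ , y≢y′ , ly , ly′) = inj₁ (two-light⇒k+2≤degree occurs y≢y′ ly ly′)
    ... | no ¬two-light = inj₂ (one-light-coloring light-unique)
      where
      light-unique : ∀ {y y′} → Light y → Light y′ → y ≡ y′
      light-unique {y} {y′} ly ly′ with y ≟ y′
      ... | yes y≡y′ = y≡y′
      ... | no y≢y′ = ⊥-elim (¬two-light (y , y′ , y≢y′ , ly , ly′))

lemma3p3 : (k : ℕ) → 1 ≤ k → (G : Graph) →
    ¬ HasPackingColoring 2 k G →
    (∀ (H : Graph) → ProperSubgraph H G → HasPackingColoring 2 k H) →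
    (u : Fin (n G)) →
    (∀ v → Adj G u v → degree G v < 3) →
    k + 2 ≤ degree G u
lemma3p3 k _ G uncolourable minimal u small
  with k+2≤degree⊎coloring G u (restrict G u (minimal (G ─ u) (─-proper G u))) small
... | inj₁ large = large
... | inj₂ coloring = ⊥-elim (uncolourable coloring)
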